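{- For every structure $\mathfrak A$, identifying each $a\in A$ with the constant sequence $(a)_{i\in\mathbb N}$, we have $\mathfrak A\preceq_{\mathrm{pH}}\mathfrak A^{\mathrm{per}}\preceq_{\mathrm{pH}}\mathfrak A^{\mathbb N}$.
   Context: Structures are in a countable first-order language (relation, constant, function symbols allowed; equality and $\bot$ included). A positive Horn formula is built from atomic formulas using only $\wedge,\exists,\forall$. A function $\vec a:\mathbb N\to A$ is periodic if for some $k\ge1$, $\vec a(i)=\vec a(i\bmod k)$ for all $i$; the periodic power $\mathfrak A^{\mathrm{per}}$ is the substructure of the direct power $\mathfrak A^{\mathbb N}$ on the set of periodic functions. For structures $\mathfrak C\subseteq\mathfrak D$ ($\mathfrak C$ a substructure of $\mathfrak D$), $\mathfrak C\preceq_{\mathrm{pH}}\mathfrak D$ means that for every positive Horn formula $\varphi(\bar x)$ and every tuple $\bar c$ from $C$, $\mathfrak C\models\varphi(\bar c)$ iff $\mathfrak D\models\varphi(\bar c)$. -}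

module Defs where

open import Data.Nat using (ℕ; zero; suc; pred; _*_; _+_; _%_; _/_; NonZero)
open import Data.Nat.Properties using (m*n≢0)
open import Data.Nat.Divisibility using (_∣_; ∣-refl; ∣-trans; m∣m*n; n∣m*n; ∣n⇒∣m*n)
open import Data.Nat.DivMod using (m≡m%n+[m/n]*n; %-remove-+ʳ)
open import Data.Fin using (Fin; zero; suc)
open import Data.Vec.Functional using (_∷_)
open import Data.Product using (Σ; _×_; _,_; proj₁; proj₂)
open import Data.Empty using (⊥)
open import Function using (_∘_; Injective)
open import Function.Bundles using (_⇔_)
open import Relation.Binary using (IsEquivalence)
open import Relation.Binary.PropositionalEquality using (_≡_; refl; sym; cong; subst)

record Signature : Set₁ where
  field
    FunSym    : Set
    RelSym    : Set
    funArity  : FunSym → ℕ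
    relArity  : RelSym → ℕ
    -- countability of the language: symbols inject into ℕ
    funCode     : FunSym → ℕ
    funCode-inj : Injective _≡_ _≡_ funCode
    relCode     : RelSym → ℕ
    relCode-inj : Injective _≡_ _≡_ relCode

open Signature public

-- L-structures (carrier is a setoid; equality symbol is interpreted by ≈)

record Structure (L : Signature) : Set₁ where
  field
    Carrier  : Set
    _≈_      : Carrier → Carrier → Set
    isEquiv  : IsEquivalence _≈_
    fun      : (f : FunSym L) → (Fin (funArity L f) → Carrier) → Carrier
    fun-cong : ∀ f {u v} → (∀ j → u j ≈ v j) → fun f u ≈ fun f v
    rel      : (r : RelSym L) → (Fin (relArity L r) → Carrier) → Set
    rel-cong : ∀ r {u v} → (∀ j → u j ≈ v j) → rel r u → rel r v

open Structure public

data Term (L : Signature) (n : ℕ) : Set where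
  var : Fin n → Term L n
  app : (f : FunSym L) → (Fin (funArity L f) → Term L n) → Term L n

data PHFormula (L : Signature) : ℕ → Set where
  relᶠ : ∀ {n} (r : RelSym L) → (Fin (relArity L r) → Term L n) → PHFormula L n
  _≐_  : ∀ {n} → Term L n → Term L n → PHFormula L n
  ⊥ᶠ   : ∀ {n} → PHFormula L n
  _∧ᶠ_ : ∀ {n} → PHFormula L n → PHFormula L n → PHFormula L n
  ∃ᶠ   : ∀ {n} → PHFormula L (suc n) → PHFormula L n
  ∀ᶠ   : ∀ {n} → PHFormula L (suc n) → PHFormula L n

⟦_⟧ₜ : ∀ {L n} {A : Structure L} → Term L n → (Fin n → Carrier A) → Carrier A
⟦_⟧ₜ          (var x)   ρ = ρ x
⟦_⟧ₜ {A = A} (app f ts) ρ = fun A f (λ j → ⟦_⟧ₜ {A = A} (ts j) ρ)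

_⊨_[_] : ∀ {L n} (A : Structure L) → PHFormula L n → (Fin n → Carrier A) → Set
A ⊨ relᶠ r ts [ ρ ] = rel A r (λ j → ⟦_⟧ₜ {A = A} (ts j) ρ)
A ⊨ (t ≐ s)   [ ρ ] = _≈_ A (⟦_⟧ₜ {A = A} t ρ) (⟦_⟧ₜ {A = A} s ρ)
A ⊨ ⊥ᶠ        [ ρ ] = ⊥
A ⊨ (φ ∧ᶠ ψ)  [ ρ ] = (A ⊨ φ [ ρ ]) × (A ⊨ ψ [ ρ ])
A ⊨ ∃ᶠ φ      [ ρ ] = Σ (Carrier A) λ a → A ⊨ φ [ a ∷ ρ ]
A ⊨ ∀ᶠ φ      [ ρ ] = (a : Carrier A) → A ⊨ φ [ a ∷ ρ ]

-- Substructures given by an identification map e : C → D (embedding),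
-- and the relation C ≼pH D

record IsEmbedding {L} (C D : Structure L) (e : Carrier C → Carrier D) : Set where
  field
    e-cong  : ∀ {a b} → _≈_ C a b → _≈_ D (e a) (e b)
    e-inj   : ∀ {a b} → _≈_ D (e a) (e b) → _≈_ C a b
    e-fun   : ∀ f u → _≈_ D (e (fun C f u)) (fun D f (e ∘ u))
    e-rel   : ∀ r u → rel C r u ⇔ rel D r (e ∘ u)

_≼pH_via_ : ∀ {L} (C D : Structure L) → (Carrier C → Carrier D) → Set
C ≼pH D via e =
  IsEmbedding C D e ×
  (∀ {n} (φ : PHFormula _ n) (ρ : Fin n → Carrier C) → (C ⊨ φ [ ρ ]) ⇔ (D ⊨ φ [ e ∘ ρ ]))

module _ {L : Signature} (A : Structure L) where
  private
    module E = IsEquivalence (isEquiv A)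
    _≈A_ : Carrier A → Carrier A → Set
    _≈A_ = _≈_ A

  power : Structure L
  power = record
    { Carrier  = ℕ → Carrier A
    ; _≈_      = λ a b → ∀ i → a i ≈A b i
    ; isEquiv  = record { refl = λ i → E.refl ; sym = λ p i → E.sym (p i)
                        ; trans = λ p q i → E.trans (p i) (q i) }
    ; fun      = λ f u i → fun A f (λ j → u j i)
    ; fun-cong = λ f p i → fun-cong A f (λ j → p j i)
    ; rel      = λ r u → ∀ i → rel A r (λ j → u j i)
    ; rel-cong = λ r p x i → rel-cong A r (λ j → p j i) (x i)
    }

  -- a : ℕ → A is periodic: a(i) = a(i mod k) for some k ≥ 1 (k written suc k')
  Periodic : (ℕ → Carrier A) → Set
  Periodic a = Σ ℕ λ k′ → ∀ i → a i ≈A a (i % suc k′)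

  private
    prodP : ∀ n → (Fin n → ℕ) → ℕ
    prodP zero    g = 1
    prodP (suc n) g = suc (g zero) * prodP n (g ∘ suc)

    prodP-nz : ∀ n g → NonZero (prodP n g)
    prodP-nz zero g = _
    prodP-nz (suc n) g = m*n≢0 (suc (g zero)) (prodP n (g ∘ suc)) {{_}} {{prodP-nz n (g ∘ suc)}}

    prodP-∣ : ∀ n g (j : Fin n) → suc (g j) ∣ prodP n g
    prodP-∣ (suc n) g zero    = m∣m*n (prodP n (g ∘ suc))
    prodP-∣ (suc n) g (suc j) = ∣-trans (prodP-∣ n (g ∘ suc) j) (n∣m*n (suc (g zero)))

    mod-mod : ∀ i d P .{{_ : NonZero d}} .{{_ : NonZero P}} → d ∣ P → (i % P) % d ≡ i % d
    mod-mod i d P d∣P = sym (subst (λ x → x % d ≡ (i % P) % d) (sym (m≡m%n+[m/n]*n i P))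
                          (%-remove-+ʳ (i % P) (∣n⇒∣m*n (i / P) d∣P)))

    widen : ∀ (a : ℕ → Carrier A) k′ Q → suc k′ ∣ suc Q →
            (∀ i → a i ≈A a (i % suc k′)) → ∀ i → a i ≈A a (i % suc Q)
    widen a k′ Q d∣P p i =
      E.trans (p i) (E.sym (subst (λ x → a (i % suc Q) ≈A a x) (mod-mod i (suc k′) (suc Q) d∣P) (p (i % suc Q))))

    sucpred : ∀ m .{{_ : NonZero m}} → suc (pred m) ≡ m
    sucpred (suc m) = refl

    fun-per : ∀ f (u : Fin (funArity L f) → Σ (ℕ → Carrier A) Periodic) →
              Periodic (λ i → fun A f (λ j → proj₁ (u j) i))
    fun-per f u = pred P , λ i →
        fun-cong A f (λ j → widen (proj₁ (u j)) (proj₁ (proj₂ (u j))) (pred P)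
                              (subst (suc (ks j) ∣_) (sym (sucpred P {{prodP-nz n ks}})) (prodP-∣ n ks j))
                              (proj₂ (proj₂ (u j))) i)
      where
        n  = funArity L f
        ks = λ j → proj₁ (proj₂ (u j))
        P  = prodP n ks

  perPower : Structure L
  perPower = record
    { Carrier  = Σ (ℕ → Carrier A) Periodic
    ; _≈_      = λ a b → _≈_ power (proj₁ a) (proj₁ b)
    ; isEquiv  = record { refl = λ i → E.refl ; sym = λ p i → E.sym (p i)
                        ; trans = λ p q i → E.trans (p i) (q i) }
    ; fun      = λ f u → fun power f (proj₁ ∘ u) , fun-per f u
    ; fun-cong = λ f p → fun-cong power f p
    ; rel      = λ r u → rel power r (proj₁ ∘ u)
    ; rel-cong = λ r p → rel-cong power r p
    }

  constSeq : Carrier A → Carrier perPower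
  constSeq a = (λ _ → a) , (0 , λ _ → E.refl)

  perIncl : Carrier perPower → Carrier power
  perIncl = proj₁

-- Positive Horn formulas are evaluated coordinatewise in a direct power 𝔄^ℕ:
-- atoms, ∧ and ∀ trivially so, and ∃ because witnesses chosen separately in
-- each coordinate form a sequence.  In 𝔄^per the same works once the witness
-- at i is chosen to be the one at i mod Q, for Q a common period of the
-- parameters: the resulting sequence is periodic.  So in both powers
-- φ(σ) holds iff it holds in every coordinate, which for a tuple of constant
-- sequences means 𝔄 ⊨ φ.
module Submission where

open import Defs
open import Data.Nat using (ℕ; zero; suc; pred; _*_; _%_)
open import Data.Nat.Divisibility using (_∣_; ∣-trans; m∣m*n; n∣m*n)
open import Data.Nat.DivMod using (m∣n⇒o%n%m≡o%m; m%n%n≡m%n)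
open import Data.Fin using (Fin; zero; suc)
open import Data.Vec.Functional using (_∷_)
open import Data.Product using (_×_; _,_; proj₁; proj₂)
open import Function using (_∘_)
open import Function.Bundles using (_⇔_; mk⇔; Equivalence)
open import Function.Construct.Composition using (_⇔-∘_)
open import Function.Construct.Symmetry using (⇔-sym)
open import Relation.Binary using (IsEquivalence)
open import Relation.Binary.PropositionalEquality using (cong; sym)

open Equivalence using (to; from)

module _ {L : Signature} (B : Structure L) where
  private
    module ≈B = IsEquivalence (isEquiv B)

  _≈ₑ_ : ∀ {n} → (Fin n → Carrier B) → (Fin n → Carrier B) → Set
  ρ ≈ₑ ρ′ = ∀ x → _≈_ B (ρ x) (ρ′ x)

  ∷-cong : ∀ {n} {a a′ : Carrier B} {ρ ρ′ : Fin n → Carrier B} →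
           _≈_ B a a′ → ρ ≈ₑ ρ′ → (a ∷ ρ) ≈ₑ (a′ ∷ ρ′)
  ∷-cong q p zero    = q
  ∷-cong q p (suc x) = p x

  ⟦⟧ₜ-cong : ∀ {n} (t : Term L n) {ρ ρ′} → ρ ≈ₑ ρ′ → _≈_ B (⟦_⟧ₜ {A = B} t ρ) (⟦_⟧ₜ {A = B} t ρ′)
  ⟦⟧ₜ-cong (var x)    p = p x
  ⟦⟧ₜ-cong (app f ts) p = fun-cong B f (λ j → ⟦⟧ₜ-cong (ts j) p)

  ⊨-cong : ∀ {n} (φ : PHFormula L n) {ρ ρ′} → ρ ≈ₑ ρ′ → B ⊨ φ [ ρ ] → B ⊨ φ [ ρ′ ]
  ⊨-cong (relᶠ r ts) p h       = rel-cong B r (λ j → ⟦⟧ₜ-cong (ts j) p) h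
  ⊨-cong (t ≐ s)     p h       = ≈B.trans (≈B.sym (⟦⟧ₜ-cong t p)) (≈B.trans h (⟦⟧ₜ-cong s p))
  ⊨-cong ⊥ᶠ          p ()
  ⊨-cong (φ ∧ᶠ ψ)    p (h , k) = ⊨-cong φ p h , ⊨-cong ψ p k
  ⊨-cong (∃ᶠ φ)      p (a , h) = a , ⊨-cong φ (∷-cong ≈B.refl p) h
  ⊨-cong (∀ᶠ φ)      p h a     = ⊨-cong φ (∷-cong ≈B.refl p) (h a)

-- A structure B whose elements are read as sequences in A, with everything
-- interpreted coordinatewise.  B need not contain every sequence: a finite
-- tuple σ comes with a reindexing of ℕ that leaves σ unchanged, and only
-- sequences pulled back along that reindexing must be realised in B.
record Subpower {L : Signature} (A B : Structure L) : Set where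
  field
    _at_          : Carrier B → ℕ → Carrier A
    ≈⇔pointwise   : ∀ {b c} → _≈_ B b c ⇔ (∀ i → _≈_ A (b at i) (c at i))
    fun-at        : ∀ f u i → _≈_ A (fun B f u at i) (fun A f (λ j → u j at i))
    rel⇔pointwise : ∀ r u → rel B r u ⇔ (∀ i → rel A r (λ j → u j at i))
    reindex       : ∀ {n} → (Fin n → Carrier B) → ℕ → ℕ
    at-reindex    : ∀ {n} (σ : Fin n → Carrier B) x i → _≈_ A (σ x at reindex σ i) (σ x at i)
    glue          : ∀ {n} → (Fin n → Carrier B) → (ℕ → Carrier A) → Carrier B
    glue-at       : ∀ {n} σ a i → _≈_ A (glue {n} σ a at i) (a (reindex σ i))

module SubpowerProperties {L : Signature} {A B : Structure L} (S : Subpower A B) where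
  open Subpower S
  private
    module ≈A = IsEquivalence (isEquiv A)

  _at-all_ : ∀ {n} → (Fin n → Carrier B) → ℕ → Fin n → Carrier A
  (σ at-all i) x = σ x at i

  ⟦⟧ₜ-at : ∀ {n} (t : Term L n) σ i → _≈_ A (⟦_⟧ₜ {A = B} t σ at i) (⟦_⟧ₜ {A = A} t (σ at-all i))
  ⟦⟧ₜ-at (var x)    σ i = ≈A.refl
  ⟦⟧ₜ-at (app f ts) σ i = ≈A.trans (fun-at f _ i) (fun-cong A f (λ j → ⟦⟧ₜ-at (ts j) σ i))

  ∷-at : ∀ {n} (b : Carrier B) (σ : Fin n → Carrier B) i →
         _≈ₑ_ A ((b ∷ σ) at-all i) (b at i ∷ σ at-all i)
  ∷-at b σ i zero    = ≈A.refl
  ∷-at b σ i (suc x) = ≈A.refl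

  ⊨⇒pointwise : ∀ {n} (φ : PHFormula L n) σ → B ⊨ φ [ σ ] → ∀ i → A ⊨ φ [ σ at-all i ]
  ⊨⇒pointwise (relᶠ r ts) σ h i = rel-cong A r (λ j → ⟦⟧ₜ-at (ts j) σ i) (to (rel⇔pointwise r _) h i)
  ⊨⇒pointwise (t ≐ s) σ h i =
    ≈A.trans (≈A.sym (⟦⟧ₜ-at t σ i)) (≈A.trans (to ≈⇔pointwise h i) (⟦⟧ₜ-at s σ i))
  ⊨⇒pointwise (φ ∧ᶠ ψ) σ (h , k) i = ⊨⇒pointwise φ σ h i , ⊨⇒pointwise ψ σ k i
  ⊨⇒pointwise (∃ᶠ φ) σ (b , h) i = b at i , ⊨-cong A φ (∷-at b σ i) (⊨⇒pointwise φ (b ∷ σ) h i)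
  ⊨⇒pointwise (∀ᶠ φ) σ h i a =
    ⊨-cong A φ (λ x → ≈A.trans (∷-at b σ i x) (b-at-i x)) (⊨⇒pointwise φ (b ∷ σ) (h b) i)
    where
      b = glue σ (λ _ → a)
      b-at-i : _≈ₑ_ A (b at i ∷ σ at-all i) (a ∷ σ at-all i)
      b-at-i = ∷-cong A (glue-at σ (λ _ → a) i) (λ _ → ≈A.refl)

  pointwise⇒⊨ : ∀ {n} (φ : PHFormula L n) σ → (∀ i → A ⊨ φ [ σ at-all i ]) → B ⊨ φ [ σ ]
  pointwise⇒⊨ (relᶠ r ts) σ h =
    from (rel⇔pointwise r _) (λ i → rel-cong A r (λ j → ≈A.sym (⟦⟧ₜ-at (ts j) σ i)) (h i))
  pointwise⇒⊨ (t ≐ s) σ h =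
    from ≈⇔pointwise (λ i → ≈A.trans (⟦⟧ₜ-at t σ i) (≈A.trans (h i) (≈A.sym (⟦⟧ₜ-at s σ i))))
  pointwise⇒⊨ ⊥ᶠ σ h = h 0
  pointwise⇒⊨ (φ ∧ᶠ ψ) σ h = pointwise⇒⊨ φ σ (proj₁ ∘ h) , pointwise⇒⊨ ψ σ (proj₂ ∘ h)
  pointwise⇒⊨ (∃ᶠ φ) σ h =
    b , pointwise⇒⊨ φ (b ∷ σ) (λ i → ⊨-cong A φ (reindexed i) (proj₂ (h (reindex σ i))))
    where
      witness : ℕ → Carrier A
      witness i = proj₁ (h i)
      b = glue σ witness
      reindexed : ∀ i → _≈ₑ_ A (witness (reindex σ i) ∷ σ at-all reindex σ i) ((b ∷ σ) at-all i)
      reindexed i x = ≈A.trans (∷-cong A (≈A.sym (glue-at σ witness i)) (λ y → at-reindex σ y i) x)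
                               (≈A.sym (∷-at b σ i x))
  pointwise⇒⊨ (∀ᶠ φ) σ h b =
    pointwise⇒⊨ φ (b ∷ σ) (λ i → ⊨-cong A φ (λ x → ≈A.sym (∷-at b σ i x)) (h i (b at i)))

  ⊨⇔pointwise : ∀ {n} (φ : PHFormula L n) σ → B ⊨ φ [ σ ] ⇔ (∀ i → A ⊨ φ [ σ at-all i ])
  ⊨⇔pointwise φ σ = mk⇔ (⊨⇒pointwise φ σ) (pointwise⇒⊨ φ σ)

-- suc (predMultiple ks) is the product of the suc (ks j), matching the
-- predecessor encoding of periods in Periodic.
predMultiple : ∀ {n} → (Fin n → ℕ) → ℕ
predMultiple {zero}  ks = 0
predMultiple {suc n} ks = pred (suc (ks zero) * suc (predMultiple (ks ∘ suc)))

suc∣suc-predMultiple : ∀ {n} (ks : Fin n → ℕ) j → suc (ks j) ∣ suc (predMultiple ks)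
suc∣suc-predMultiple ks zero    = m∣m*n (suc (predMultiple (ks ∘ suc)))
suc∣suc-predMultiple ks (suc j) = ∣-trans (suc∣suc-predMultiple (ks ∘ suc) j) (n∣m*n (suc (ks zero)))

module _ {L : Signature} (A : Structure L) where
  private
    module ≈A = IsEquivalence (isEquiv A)

  period-∣ : ∀ {a : ℕ → Carrier A} {k q} → (∀ i → _≈_ A (a i) (a (i % suc k))) → suc k ∣ suc q →
             ∀ i → _≈_ A (a i) (a (i % suc q))
  period-∣ {a} {k} {q} p k∣q i =
    ≈A.trans (p i) (≈A.sym (≈A.trans (p (i % suc q))
                                     (≈A.reflexive (cong a (m∣n⇒o%n%m≡o%m (suc k) (suc q) i k∣q)))))

  commonPeriod : ∀ {n} → (Fin n → Carrier (perPower A)) → ℕ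
  commonPeriod σ = predMultiple (λ x → proj₁ (proj₂ (σ x)))

  power-subpower : Subpower A (power A)
  power-subpower = record
    { _at_          = λ a i → a i
    ; ≈⇔pointwise   = mk⇔ (λ p → p) (λ p → p)
    ; fun-at        = λ f u i → ≈A.refl
    ; rel⇔pointwise = λ r u → mk⇔ (λ h → h) (λ h → h)
    ; reindex       = λ σ i → i
    ; at-reindex    = λ σ x i → ≈A.refl
    ; glue          = λ σ a → a
    ; glue-at       = λ σ a i → ≈A.refl
    }

  perPower-subpower : Subpower A (perPower A)
  perPower-subpower = record
    { _at_          = proj₁
    ; ≈⇔pointwise   = mk⇔ (λ p → p) (λ p → p)
    ; fun-at        = λ f u i → ≈A.refl
    ; rel⇔pointwise = λ r u → mk⇔ (λ h → h) (λ h → h)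
    ; reindex       = λ σ i → i % suc (commonPeriod σ)
    ; at-reindex    = λ σ x i → ≈A.sym (period-∣ (proj₂ (proj₂ (σ x)))
                                          (suc∣suc-predMultiple (λ y → proj₁ (proj₂ (σ y))) x) i)
    ; glue          = λ σ a → (λ i → a (i % suc (commonPeriod σ)))
                            , commonPeriod σ
                            , λ i → ≈A.reflexive (cong a (sym (m%n%n≡m%n i (suc (commonPeriod σ)))))
    ; glue-at       = λ σ a i → ≈A.refl
    }

  private
    module Per = SubpowerProperties perPower-subpower
    module Pow = SubpowerProperties power-subpower

  constSeq-isEmbedding : IsEmbedding A (perPower A) (constSeq A)
  constSeq-isEmbedding = record
    { e-cong = λ p i → p ; e-inj = λ p → p 0 ; e-fun = λ f u i → ≈A.refl
    ; e-rel = λ r u → mk⇔ (λ h i → h) (λ h → h 0) }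

  perIncl-isEmbedding : IsEmbedding (perPower A) (power A) (perIncl A)
  perIncl-isEmbedding = record
    { e-cong = λ p → p ; e-inj = λ p → p ; e-fun = λ f u i → ≈A.refl
    ; e-rel = λ r u → mk⇔ (λ h → h) (λ h → h) }

  ⊨⇔⊨-constSeq : ∀ {n} (φ : PHFormula L n) ρ → (A ⊨ φ [ ρ ]) ⇔ (perPower A ⊨ φ [ constSeq A ∘ ρ ])
  ⊨⇔⊨-constSeq φ ρ = mk⇔ (λ h → Per.pointwise⇒⊨ φ _ (λ _ → h)) (λ h → Per.⊨⇒pointwise φ _ h 0)

  ⊨⇔⊨-perIncl : ∀ {n} (φ : PHFormula L n) σ → (perPower A ⊨ φ [ σ ]) ⇔ (power A ⊨ φ [ perIncl A ∘ σ ])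
  ⊨⇔⊨-perIncl φ σ = ⇔-sym (Pow.⊨⇔pointwise φ (perIncl A ∘ σ)) ⇔-∘ Per.⊨⇔pointwise φ σ

proposition4p3 : (L : Signature) (A : Structure L) →
    (A ≼pH perPower A via constSeq A) × (perPower A ≼pH power A via perIncl A)
proposition4p3 L A =
  (constSeq-isEmbedding A , ⊨⇔⊨-constSeq A) , (perIncl-isEmbedding A , ⊨⇔⊨-perIncl A)
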